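{- For every positive integer $m$ there exists a constant $C$ (depending on $m$) such that $RR(A_m,C_n)\le (m-1)n+C$ for all positive integers $n$.
   Context: For a positive integer $N$, $\mathcal{B}_N$ denotes the Boolean lattice of all subsets of $[N]=\{1,\dots,N\}$ ordered by inclusion. A family $\mathcal{G}$ of sets is a copy of a poset $P$ if there is a bijection $\phi:P\to\mathcal{G}$ with $x<_P y$ if and only if $\phi(x)\subsetneq\phi(y)$. A coloring of $\mathcal{B}_N$ is any map from $\mathcal{B}_N$ to the positive integers. Under a coloring, a monochromatic $P$ is a copy of $P$ all of whose sets have the same color, and a rainbow $Q$ is a copy of $Q$ whose sets have pairwise distinct colors. $RR(P,Q)$ is the minimum integer $N$ such that every coloring of $\mathcal{B}_N$ contains a monochromatic $P$ or a rainbow $Q$. $C_k$ denotes the chain with $k$ elements and $A_k$ the antichain with $k$ elements. -}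

module Defs where

open import Data.Nat using (ℕ)
open import Data.Fin using (Fin)
import Data.Fin as Fin
open import Data.Fin.Subset using (Subset; _⊂_)
open import Data.Product using (_×_; Σ; ∃)
open import Data.Empty using (⊥)
open import Relation.Binary.PropositionalEquality using (_≡_)
open import Function.Definitions using (Injective)
open import Function.Bundles using (_⇔_)

-- The Boolean lattice B_N: subsets of [N] (encoded as Subset N, i.e. subsets of Fin N),
-- ordered by inclusion; strict inclusion is _⊂_.

IsCopy : {k : ℕ} (P< : Fin k → Fin k → Set) (N : ℕ) → (Fin k → Subset N) → Set
IsCopy {k} P< N φ =
  Injective _≡_ _≡_ φ × ((x y : Fin k) → P< x y ⇔ (φ x ⊂ φ y))

ChainRel : (k : ℕ) → Fin k → Fin k → Set
ChainRel k x y = x Fin.< y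

AntichainRel : (k : ℕ) → Fin k → Fin k → Set
AntichainRel k x y = ⊥

-- Colorings of B_N (colors are natural numbers; only equality of colors matters).
Coloring : ℕ → Set
Coloring N = Subset N → ℕ

MonochromaticCopy : {k : ℕ} (P< : Fin k → Fin k → Set) (N : ℕ) → Coloring N → Set
MonochromaticCopy {k} P< N c =
  Σ (Fin k → Subset N) λ φ → IsCopy P< N φ × ((x y : Fin k) → c (φ x) ≡ c (φ y))

RainbowCopy : {k : ℕ} (Q< : Fin k → Fin k → Set) (N : ℕ) → Coloring N → Set
RainbowCopy {k} Q< N c =
  Σ (Fin k → Subset N) λ φ → IsCopy Q< N φ × Injective _≡_ _≡_ (λ x → c (φ x))

open import Data.Sum using (_⊎_)

RRProperty : {k l : ℕ} (P< : Fin k → Fin k → Set) (Q< : Fin l → Fin l → Set) → ℕ → Set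
RRProperty P< Q< N = (c : Coloring N) → MonochromaticCopy P< N c ⊎ RainbowCopy Q< N c

-- RR(P,Q) ≤ B : the minimum N ≥ 1 with the property exists and is ≤ B,
-- equivalently some positive N ≤ B has the property.
open import Data.Nat using (_≤_; _<_)

RR≤ : {k l : ℕ} (P< : Fin k → Fin k → Set) (Q< : Fin l → Fin l → Set) → ℕ → Set
RR≤ P< Q< B = ∃ λ N → 0 < N × N ≤ B × RRProperty P< Q< N

-- Build a rainbow chain ∅ = A₀ ⊂ A₁ ⊂ ⋯ ⊂ A_{n-1} of proper subsets greedily.
-- Given a proper A, look for a largest proper S ⊇ A of the colour of A, then a
-- largest one containing A and an element outside the first, and so on: each new
-- set contains a point missing from every earlier one, and by maximality is not
-- strictly contained in an earlier one, so the sets form a monochromatic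
-- antichain. If m sets are found we are done; otherwise the search stops at some
-- X ⊋ A with ∣X∣ ≤ ∣A∣ + m - 1 above which no proper set has the colour of A,
-- and X becomes the next link. Hence N = (m - 1)(n - 1) + 1 already suffices.
module Submission where

open import Defs
open import Data.Nat using (ℕ; zero; suc; _+_; _*_; _∸_; _<_; _≤_; z≤n; s≤s)
import Data.Nat as ℕ
open import Data.Nat.Properties
open import Data.Product using (∃; _×_; _,_; proj₁; proj₂)
open import Data.Sum using (_⊎_; inj₁; inj₂)
import Data.Sum as Sum
open import Data.Empty using (⊥; ⊥-elim)
open import Data.Fin using (Fin; zero; suc)
import Data.Fin as F
import Data.Fin.Properties as FP
open import Data.Fin.Subset renaming (⊥ to ∅)
open import Data.Fin.Subset.Properties
open import Data.Vec using (_∷_; [])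
open import Data.Vec.Properties using (≡-dec)
open import Data.Vec.Functional using () renaming (_∷_ to _◃_)
import Data.Bool as Bool
open import Function using (_∘_)
open import Function.Bundles using (mk⇔)
open import Function.Definitions using (Injective)
open import Relation.Binary.PropositionalEquality
open import Relation.Binary.Definitions using (tri<; tri≈; tri>)
open import Relation.Nullary
open import Relation.Unary using (Pred; Decidable)
open import Level using (0ℓ)

injective-from-tail : ∀ {a} {A : Set a} {k} {f : Fin (suc k) → A} →
  (∀ i → f (suc i) ≢ f zero) → Injective _≡_ _≡_ (f ∘ suc) → Injective _≡_ _≡_ f
injective-from-tail fresh inj {zero}  {zero}  _ = refl
injective-from-tail fresh inj {zero}  {suc j} e = ⊥-elim (fresh j (sym e))
injective-from-tail fresh inj {suc i} {zero}  e = ⊥-elim (fresh i e)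
injective-from-tail fresh inj {suc i} {suc j} e = cong suc (inj e)

Proper : ∀ {n} → Subset n → Set
Proper p = p ≢ ⊤

∣p∣<n⇒proper : ∀ {n} {p : Subset n} → ∣ p ∣ < n → Proper p
∣p∣<n⇒proper {n} lt refl = <-irrefl (∣⊤∣≡n n) lt

proper⇒∃∉ : ∀ {n} {p : Subset n} → Proper p → ∃ λ x → x ∉ p
proper⇒∃∉ {n} {p} p≢⊤ = FP.¬∀⟶∃¬ n (_∈ p) (_∈? p) λ all∈ → p≢⊤ (⊆-antisym ⊆⊤ (λ {x} _ → all∈ x))

⊆∧⊉⇒⊂ : ∀ {n} {p q : Subset n} → p ⊆ q → ¬ (q ⊆ p) → p ⊂ q
⊆∧⊉⇒⊂ {p = p} {q} p⊆q q⊈p with FP.any? (λ x → (x ∈? q) ×-dec ¬? (x ∈? p))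
... | yes (x , x∈q , x∉p) = p⊆q , x , x∈q , x∉p
... | no none = ⊥-elim (q⊈p q⊆p)
  where
  q⊆p : q ⊆ p
  q⊆p {x} x∈q with x ∈? p
  ... | yes x∈p = x∈p
  ... | no x∉p = ⊥-elim (none (x , x∈q , x∉p))

⊆∧∣⊇∣⇒≡ : ∀ {n} {p q : Subset n} → p ⊆ q → ∣ q ∣ ≤ ∣ p ∣ → p ≡ q
⊆∧∣⊇∣⇒≡ {p = p} {q} p⊆q ∣q∣≤∣p∣ with q ⊆? p
... | yes q⊆p = ⊆-antisym p⊆q q⊆p
... | no q⊈p = ⊥-elim (<⇒≱ (p⊂q⇒∣p∣<∣q∣ (⊆∧⊉⇒⊂ p⊆q q⊈p)) ∣q∣≤∣p∣)

∣p∪q∣≤∣p∣+∣q∣ : ∀ {n} (p q : Subset n) → ∣ p ∪ q ∣ ≤ ∣ p ∣ + ∣ q ∣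
∣p∪q∣≤∣p∣+∣q∣ []             []             = z≤n
∣p∪q∣≤∣p∣+∣q∣ (inside  ∷ p) (inside  ∷ q) = s≤s (≤-trans (∣p∪q∣≤∣p∣+∣q∣ p q) (+-monoʳ-≤ ∣ p ∣ (n≤1+n ∣ q ∣)))
∣p∪q∣≤∣p∣+∣q∣ (inside  ∷ p) (outside ∷ q) = s≤s (∣p∪q∣≤∣p∣+∣q∣ p q)
∣p∪q∣≤∣p∣+∣q∣ (outside ∷ p) (inside  ∷ q) = ≤-trans (s≤s (∣p∪q∣≤∣p∣+∣q∣ p q)) (≤-reflexive (sym (+-suc _ _)))
∣p∪q∣≤∣p∣+∣q∣ (outside ∷ p) (outside ∷ q) = ∣p∪q∣≤∣p∣+∣q∣ p q

Largest : ∀ {n ℓ} → Pred (Subset n) ℓ → Pred (Subset n) ℓ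
Largest P S = P S × (∀ T → P T → ∣ T ∣ ≤ ∣ S ∣)

largest? : ∀ {n ℓ} {P : Pred (Subset n) ℓ} → Decidable P → (∀ S → ¬ P S) ⊎ ∃ (Largest P)
largest? {zero} P? with P? []
... | yes p = inj₂ ([] , p , λ { [] _ → z≤n })
... | no ¬p = inj₁ λ { [] → ¬p }
largest? {suc n} P? with largest? (P? ∘ (outside ∷_)) | largest? (P? ∘ (inside ∷_))
... | inj₁ none₀ | inj₁ none₁ = inj₁ λ { (outside ∷ S) → none₀ S ; (inside ∷ S) → none₁ S }
... | inj₁ none₀ | inj₂ (S , p , max) =
  inj₂ (inside ∷ S , p , λ { (outside ∷ T) q → ⊥-elim (none₀ T q) ; (inside ∷ T) q → s≤s (max T q) })
... | inj₂ (S , p , max) | inj₁ none₁ =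
  inj₂ (outside ∷ S , p , λ { (outside ∷ T) q → max T q ; (inside ∷ T) q → ⊥-elim (none₁ T q) })
... | inj₂ (S₀ , p₀ , max₀) | inj₂ (S₁ , p₁ , max₁) with ∣ S₀ ∣ ≤? suc ∣ S₁ ∣
...   | yes ≤₁ = inj₂ (inside ∷ S₁ , p₁ ,
          λ { (outside ∷ T) q → ≤-trans (max₀ T q) ≤₁ ; (inside ∷ T) q → s≤s (max₁ T q) })
...   | no ≰₁ = inj₂ (outside ∷ S₀ , p₀ ,
          λ { (outside ∷ T) q → max₀ T q ; (inside ∷ T) q → ≤-trans (s≤s (max₁ T q)) (<⇒≤ (≰⇒> ≰₁)) })

module _ {N : ℕ} (c : Coloring N) where

  Rival : Subset N → Pred (Subset N) 0ℓ
  Rival A S = Proper S × c S ≡ c A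

  rival? : (A : Subset N) → Decidable (Rival A)
  rival? A S = ¬? (≡-dec Bool._≟_ S ⊤) ×-dec (c S ℕ.≟ c A)

  -- The search for an antichain of rivals of A after k choices; every later
  -- choice must contain front.
  record Greedy (A : Subset N) (k : ℕ) : Set where
    field
      front            : Subset N
      A⊆front          : A ⊆ front
      ∣front∣≤         : ∣ front ∣ ≤ ∣ A ∣ + k
      chosen           : Fin k → Subset N
      chosen-colour    : ∀ i → c (chosen i) ≡ c A
      chosen-antichain : ∀ i j → chosen i ⊆ chosen j → i ≡ j
      front⊈chosen     : ∀ i → ¬ (front ⊆ chosen i)
      chosen-largest   : ∀ i T → front ⊆ T → Rival A T → ∣ T ∣ ≤ ∣ chosen i ∣

  RivalAbove : {A : Subset N} {k : ℕ} → Greedy A k → Pred (Subset N) 0ℓ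
  RivalAbove {A} g S = Greedy.front g ⊆ S × Rival A S

  start : (A : Subset N) → Greedy A 0
  start A = record
    { front = A ; A⊆front = ⊆-refl ; ∣front∣≤ = ≤-reflexive (sym (+-identityʳ ∣ A ∣))
    ; chosen = λ () ; chosen-colour = λ () ; chosen-antichain = λ ()
    ; front⊈chosen = λ () ; chosen-largest = λ () }

  -- The new front contains a point outside S, so no later choice lies inside S.
  push : ∀ {A k} (g : Greedy A k) {S : Subset N} → Largest (RivalAbove g) S → Greedy A (suc k)
  push {A} {k} g {S} ((front⊆S , S-proper , S-colour) , S-largest) = record
    { front = front′ ; A⊆front = ⊆-trans A⊆front front⊆front′
    ; ∣front∣≤ = ∣front′∣≤
    ; chosen = S ◃ chosen ; chosen-colour = colour′ ; chosen-antichain = antichain′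
    ; front⊈chosen = front′⊈ ; chosen-largest = largest′ }
    where
    open Greedy g
    d : Fin N
    d = proj₁ (proper⇒∃∉ S-proper)
    front′ : Subset N
    front′ = front ∪ ⁅ d ⁆
    front⊆front′ : front ⊆ front′
    front⊆front′ = p⊆p∪q ⁅ d ⁆
    ∣front′∣≤ : ∣ front′ ∣ ≤ ∣ A ∣ + suc k
    ∣front′∣≤ = begin
      ∣ front ∪ ⁅ d ⁆ ∣     ≤⟨ ∣p∪q∣≤∣p∣+∣q∣ front ⁅ d ⁆ ⟩
      ∣ front ∣ + ∣ ⁅ d ⁆ ∣ ≡⟨ cong (∣ front ∣ +_) (∣⁅x⁆∣≡1 d) ⟩
      ∣ front ∣ + 1         ≤⟨ +-monoˡ-≤ 1 ∣front∣≤ ⟩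
      ∣ A ∣ + k + 1         ≡⟨ +-assoc ∣ A ∣ k 1 ⟩
      ∣ A ∣ + (k + 1)       ≡⟨ cong (∣ A ∣ +_) (+-comm k 1) ⟩
      ∣ A ∣ + suc k         ∎
      where open ≤-Reasoning
    colour′ : ∀ i → c ((S ◃ chosen) i) ≡ c A
    colour′ zero = S-colour
    colour′ (suc i) = chosen-colour i
    antichain′ : ∀ i j → (S ◃ chosen) i ⊆ (S ◃ chosen) j → i ≡ j
    antichain′ zero zero _ = refl
    antichain′ zero (suc j) S⊆j = ⊥-elim (front⊈chosen j (⊆-trans front⊆S S⊆j))
    antichain′ (suc i) zero i⊆S = ⊥-elim (front⊈chosen i
      (subst (front ⊆_) (sym (⊆∧∣⊇∣⇒≡ i⊆S (chosen-largest i S front⊆S (S-proper , S-colour)))) front⊆S))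
    antichain′ (suc i) (suc j) i⊆j = cong suc (chosen-antichain i j i⊆j)
    front′⊈ : ∀ i → ¬ (front′ ⊆ (S ◃ chosen) i)
    front′⊈ zero front′⊆S = proj₂ (proper⇒∃∉ S-proper) (front′⊆S (q⊆p∪q front ⁅ d ⁆ (x∈⁅x⁆ d)))
    front′⊈ (suc i) front′⊆ = front⊈chosen i (⊆-trans front⊆front′ front′⊆)
    largest′ : ∀ i T → front′ ⊆ T → Rival A T → ∣ T ∣ ≤ ∣ (S ◃ chosen) i ∣
    largest′ zero T front′⊆T rival = S-largest T (⊆-trans front⊆front′ front′⊆T , rival)
    largest′ (suc i) T front′⊆T rival = chosen-largest i T (⊆-trans front⊆front′ front′⊆T) rival

  antichain : ∀ {A k} → Greedy A k → MonochromaticCopy (AntichainRel k) N c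
  antichain g = chosen , (injective , λ i j → mk⇔ (λ ()) incomparable) ,
    λ i j → trans (chosen-colour i) (sym (chosen-colour j))
    where
    open Greedy g
    injective : Injective _≡_ _≡_ chosen
    injective {i} {j} e = chosen-antichain i j (⊆-reflexive e)
    incomparable : ∀ {i j} → chosen i ⊂ chosen j → ⊥
    incomparable {i} {j} i⊂j = ⊂-irref (cong chosen (chosen-antichain i j (p⊂q⇒p⊆q i⊂j))) i⊂j

  record Step (A : Subset N) (t : ℕ) : Set where
    field
      next           : Subset N
      A⊂next         : A ⊂ next
      ∣next∣≤        : ∣ next ∣ ≤ ∣ A ∣ + t
      no-rival-above : ∀ S → next ⊆ S → ¬ Rival A S

  module _ {A : Subset N} (A-proper : Proper A) where

    -- A itself is a rival of A, so a front with no rival above it is not inside A.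
    stop : ∀ {k} (g : Greedy A k) → (∀ S → ¬ RivalAbove g S) → ∀ {t} → k ≤ t → Step A t
    stop g none k≤t = record
      { next = front
      ; A⊂next = ⊆∧⊉⇒⊂ A⊆front λ front⊆A → none A (front⊆A , A-proper , refl)
      ; ∣next∣≤ = ≤-trans ∣front∣≤ (+-monoʳ-≤ ∣ A ∣ k≤t)
      ; no-rival-above = λ S front⊆S rival → none S (front⊆S , rival) }
      where open Greedy g

    greedy : ∀ f {k} → Greedy A k → MonochromaticCopy (AntichainRel (suc (f + k))) N c ⊎ Step A (f + k)
    greedy f {k} g with largest? (λ S → Greedy.front g ⊆? S ×-dec rival? A S)
    greedy f       {k} g | inj₁ none = inj₂ (stop g none (m≤n+m k f))
    greedy zero        g | inj₂ (_ , S-largest) = inj₁ (antichain (push g S-largest))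
    greedy (suc f) {k} g | inj₂ (_ , S-largest) =
      subst (λ t → MonochromaticCopy (AntichainRel (suc t)) N c ⊎ Step A t) (+-suc f k)
        (greedy f (push g S-largest))

    antichainOrStep : ∀ m′ → MonochromaticCopy (AntichainRel (suc m′)) N c ⊎ Step A m′
    antichainOrStep m′ = subst (λ t → MonochromaticCopy (AntichainRel (suc t)) N c ⊎ Step A t)
      (+-identityʳ m′) (greedy m′ (start A))

  record RainbowChainAbove (A : Subset N) (n : ℕ) : Set where
    field
      link        : Fin n → Subset N
      link-proper : ∀ i → Proper (link i)
      A⊆link      : ∀ i → A ⊆ link i
      increasing  : ∀ {i j} → i F.< j → link i ⊂ link j
      rainbow     : Injective _≡_ _≡_ (c ∘ link)

  trivialChain : {A : Subset N} → Proper A → RainbowChainAbove A 1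
  trivialChain {A} A-proper = record
    { link = λ _ → A ; link-proper = λ _ → A-proper ; A⊆link = λ _ → ⊆-refl
    ; increasing = λ { {zero} {zero} () } ; rainbow = λ { {zero} {zero} _ → refl } }

  consChain : ∀ {A t n} → Proper A → (s : Step A t) →
    RainbowChainAbove (Step.next s) n → RainbowChainAbove A (suc n)
  consChain {A} A-proper s ch = record
    { link = A ◃ link ; link-proper = proper′ ; A⊆link = A⊆link′
    ; increasing = increasing′
    ; rainbow = injective-from-tail (λ i e → no-rival-above (link i) (A⊆link i) (link-proper i , e)) rainbow }
    where
    open Step s
    open RainbowChainAbove ch
    proper′ : ∀ i → Proper ((A ◃ link) i)
    proper′ zero = A-proper
    proper′ (suc i) = link-proper i
    A⊆link′ : ∀ i → A ⊆ (A ◃ link) i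
    A⊆link′ zero = ⊆-refl
    A⊆link′ (suc i) = ⊆-trans (proj₁ A⊂next) (A⊆link i)
    increasing′ : ∀ {i j} → i F.< j → (A ◃ link) i ⊂ (A ◃ link) j
    increasing′ {zero}  {suc j} _ = ⊂-⊆-trans A⊂next (A⊆link j)
    increasing′ {suc i} {suc j} (s≤s i<j) = increasing i<j

  -- Each link costs at most m′ new points, so all n′ + 1 links stay proper.
  antichainOrRainbowChain : ∀ m′ n′ (A : Subset N) → ∣ A ∣ + m′ * n′ < N →
    MonochromaticCopy (AntichainRel (suc m′)) N c ⊎ RainbowChainAbove A (suc n′)
  antichainOrRainbowChain m′ zero A room =
    inj₂ (trivialChain (∣p∣<n⇒proper (≤-<-trans (m≤m+n _ _) room)))
  antichainOrRainbowChain m′ (suc n′) A room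
    with A-proper ← ∣p∣<n⇒proper (≤-<-trans (m≤m+n _ _) room)
    with antichainOrStep A-proper m′
  ... | inj₁ mono = inj₁ mono
  ... | inj₂ s = Sum.map₂ (consChain A-proper s) (antichainOrRainbowChain m′ n′ next room′)
    where
    open Step s
    room′ : ∣ next ∣ + m′ * n′ < N
    room′ = begin-strict
      ∣ next ∣ + m′ * n′      ≤⟨ +-monoˡ-≤ (m′ * n′) ∣next∣≤ ⟩
      ∣ A ∣ + m′ + m′ * n′    ≡⟨ +-assoc ∣ A ∣ m′ (m′ * n′) ⟩
      ∣ A ∣ + (m′ + m′ * n′)  ≡⟨ cong (∣ A ∣ +_) (*-suc m′ n′) ⟨
      ∣ A ∣ + m′ * suc n′     <⟨ room ⟩
      N                       ∎
      where open ≤-Reasoning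

  rainbowCopy : ∀ {A n} → RainbowChainAbove A n → RainbowCopy (ChainRel n) N c
  rainbowCopy ch = link , (injective , λ i j → mk⇔ increasing (reflects i j)) , rainbow
    where
    open RainbowChainAbove ch
    injective : Injective _≡_ _≡_ link
    injective e = rainbow (cong c e)
    reflects : ∀ i j → link i ⊂ link j → i F.< j
    reflects i j i⊂j with FP.<-cmp i j
    ... | tri< i<j _ _ = i<j
    ... | tri≈ _ i≡j _ = ⊥-elim (⊂-irref (cong link i≡j) i⊂j)
    ... | tri> _ _ j<i = ⊥-elim (⊂-asymmetric i⊂j (increasing j<i))

RR[A,C]≤ : ∀ m′ n′ → RR≤ (AntichainRel (suc m′)) (ChainRel (suc n′)) (suc (m′ * n′))
RR[A,C]≤ m′ n′ = suc (m′ * n′) , s≤s z≤n , ≤-refl , λ c →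
  Sum.map₂ (rainbowCopy c) (antichainOrRainbowChain c m′ n′ ∅ (subst (_< suc (m′ * n′)) room ≤-refl))
  where
  room : m′ * n′ ≡ ∣ ∅ {suc (m′ * n′)} ∣ + m′ * n′
  room = cong (_+ m′ * n′) (sym (∣⊥∣≡0 (suc (m′ * n′))))

RR≤-mono : ∀ {k l} {P : Fin k → Fin k → Set} {Q : Fin l → Fin l → Set} {B B′} →
  B ≤ B′ → RR≤ P Q B → RR≤ P Q B′
RR≤-mono B≤B′ (N , 0<N , N≤B , property) = N , 0<N , ≤-trans N≤B B≤B′ , property

mainTheorem9 : (m : ℕ) → 0 < m →
    ∃ λ (C : ℕ) → (n : ℕ) → 0 < n →
      RR≤ (AntichainRel m) (ChainRel n) ((m ∸ 1) * n + C)
mainTheorem9 (suc m′) _ = 1 , λ { (suc n′) _ → RR≤-mono (bound n′) (RR[A,C]≤ m′ n′) }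
  where
  bound : ∀ n′ → suc (m′ * n′) ≤ m′ * suc n′ + 1
  bound n′ = begin
    suc (m′ * n′)     ≤⟨ s≤s (*-monoʳ-≤ m′ (n≤1+n n′)) ⟩
    suc (m′ * suc n′) ≡⟨ +-comm 1 (m′ * suc n′) ⟩
    m′ * suc n′ + 1   ∎
    where open ≤-Reasoning
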